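{- Let $N\ge4$ be an integer and $z=1/N$. Then $\beta_n(z)\neq0$ for all $n\in\mathbb N$ (with $\mathbb N=\{1,2,\dots\}$).
   Context: The reversed Beraha polynomials $(\beta_n(X))_{n\ge0}$ are defined by $\beta_0(X)=0$, $\beta_1(X)=1$ and $\beta_{n+1}(X)=\beta_n(X)-X\beta_{n-1}(X)$ for $n\ge1$. -}

module Defs where

open import Data.Nat using (ℕ; zero; suc)
open import Data.Rational using (ℚ; 0ℚ; 1ℚ; _-_; _*_)

β : ℕ → ℚ → ℚ
β zero X = 0ℚ
β (suc zero) X = 1ℚ
β (suc (suc n)) X = β (suc n) X - X * β n X

module Submission where

-- For 0 ≤ z ≤ 1/4 the sequence bₙ = βₙ(z) never decays faster than by a
-- factor of 2:  if b_{n+1} > 0 and b_{n+1} ≤ 2 b_{n+2}, then b_{n+2} > 0 and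
-- b_{n+2} ≤ 2 b_{n+3}.  Indeed b_{n+3} = b_{n+2} − z b_{n+1} and
-- 2 z b_{n+1} ≤ (1/4)·4 b_{n+2} = b_{n+2}, so 2 b_{n+3} ≥ b_{n+2}.
-- Starting from b₁ = b₂ = 1, induction shows bₙ > 0 for every n ≥ 1.

open import Defs
open import Data.Nat using (ℕ; _≤_; NonZero)
open import Data.Integer using (+_)
open import Data.Rational using (ℚ; 0ℚ; _/_)
open import Relation.Binary.PropositionalEquality using (_≢_)

import Data.Nat as ℕ
import Data.Nat.Properties as ℕ
import Data.Integer as ℤ
open import Data.Nat.Coprimality using (1-coprimeTo)
open import Data.Rational
  using (mkℚ; 1ℚ; _+_; _-_; _*_; -_; _<_; *≤*; *<*; NonNegative; nonNegative)
  renaming (_≤_ to _≤ℚ_)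
open import Data.Rational.Properties
open import Data.Rational.Solver using (module +-*-Solver)
open import Data.Product using (_×_; _,_; proj₁)
open import Data.Empty using (⊥-elim)
open import Relation.Binary.Definitions using (tri<; tri≈; tri>)
open import Relation.Binary.PropositionalEquality using (_≡_; refl; sym; cong)

¼ : ℚ
¼ = + 1 / 4

positive-of-double : ∀ c → 0ℚ < c + c → 0ℚ < c
positive-of-double c 0<2c with <-cmp 0ℚ c
... | tri< 0<c _ _ = 0<c
... | tri≈ _ refl _ = ⊥-elim (<-irrefl refl 0<2c)
... | tri> _ _ c<0 = ⊥-elim (<-irrefl refl (<-≤-trans 0<2c (+-mono-≤ (<⇒≤ c<0) (<⇒≤ c<0))))

difference-nonNeg : ∀ {p q} → p ≤ℚ q → 0ℚ ≤ℚ q - p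
difference-nonNeg {p} {q} p≤q = begin
  0ℚ     ≡⟨ sym (+-inverseʳ p) ⟩
  p - p  ≤⟨ +-monoˡ-≤ (- p) p≤q ⟩
  q - p  ∎
  where open ≤-Reasoning

quarter-bound : ∀ z a c → 0ℚ ≤ℚ z → z ≤ℚ ¼ → 0ℚ ≤ℚ c → a ≤ℚ c + c →
                z * a + z * a ≤ℚ c
quarter-bound z a c 0≤z z≤¼ 0≤c a≤2c = begin
  z * a + z * a                    ≤⟨ +-mono-≤ z*a≤z*2c z*a≤z*2c ⟩
  z * (c + c) + z * (c + c)        ≤⟨ +-mono-≤ z*2c≤¼*2c z*2c≤¼*2c ⟩
  ¼ * (c + c) + ¼ * (c + c)        ≡⟨ four-quarters c ⟩
  c                                ∎
  where
  open ≤-Reasoning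
  instance
    z-nonNeg : NonNegative z
    z-nonNeg = nonNegative 0≤z
    2c-nonNeg : NonNegative (c + c)
    2c-nonNeg = nonNegative (+-mono-≤ 0≤c 0≤c)
  z*a≤z*2c : z * a ≤ℚ z * (c + c)
  z*a≤z*2c = *-monoˡ-≤-nonNeg z a≤2c
  z*2c≤¼*2c : z * (c + c) ≤ℚ ¼ * (c + c)
  z*2c≤¼*2c = *-monoʳ-≤-nonNeg (c + c) z≤¼
  four-quarters : ∀ c → ¼ * (c + c) + ¼ * (c + c) ≡ c
  four-quarters = +-*-Solver.solve 1
    (λ c → con ¼ :* (c :+ c) :+ con ¼ :* (c :+ c) := c) refl
    where open +-*-Solver

Controlled : ℚ → ℕ → Set
Controlled z n = (0ℚ < β (ℕ.suc n) z)
               × (β (ℕ.suc n) z ≤ℚ β (ℕ.suc (ℕ.suc n)) z + β (ℕ.suc (ℕ.suc n)) z)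

halving-step : ∀ z a c → 0ℚ ≤ℚ z → z ≤ℚ ¼ → 0ℚ < a → a ≤ℚ c + c →
               (0ℚ < c) × (c ≤ℚ (c - z * a) + (c - z * a))
halving-step z a c 0≤z z≤¼ 0<a a≤2c = 0<c , c≤2c'
  where
  open ≤-Reasoning
  0<c : 0ℚ < c
  0<c = positive-of-double c (<-≤-trans 0<a a≤2c)
  regroup : ∀ c w → c + (c - (w + w)) ≡ (c - w) + (c - w)
  regroup = +-*-Solver.solve 2 (λ c w → c :+ (c :- (w :+ w)) := (c :- w) :+ (c :- w)) refl
    where open +-*-Solver
  c≤2c' : c ≤ℚ (c - z * a) + (c - z * a)
  c≤2c' = begin
    c                              ≡⟨ sym (+-identityʳ c) ⟩
    c + 0ℚ                         ≤⟨ +-monoʳ-≤ c (difference-nonNeg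
                                        (quarter-bound z a c 0≤z z≤¼ (<⇒≤ 0<c) a≤2c)) ⟩
    c + (c - (z * a + z * a))      ≡⟨ regroup c (z * a) ⟩
    (c - z * a) + (c - z * a)      ∎

controlled : ∀ z → 0ℚ ≤ℚ z → z ≤ℚ ¼ → ∀ n → Controlled z n
controlled z 0≤z z≤¼ ℕ.zero = *<* (ℤ.+<+ (ℕ.s≤s ℕ.z≤n)) , 1≤2β₂
  where
  β₂≡1 : β 2 z ≡ 1ℚ
  β₂≡1 = cong (λ t → 1ℚ - t) (*-zeroʳ z)
  1≤2β₂ : 1ℚ ≤ℚ β 2 z + β 2 z
  1≤2β₂ rewrite β₂≡1 = *≤* (ℤ.+≤+ (ℕ.s≤s ℕ.z≤n))
controlled z 0≤z z≤¼ (ℕ.suc n) with controlled z 0≤z z≤¼ n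
... | 0<a , a≤2c = halving-step z _ _ 0≤z z≤¼ 0<a a≤2c

β-positive : ∀ z → 0ℚ ≤ℚ z → z ≤ℚ ¼ → ∀ n → 0ℚ < β (ℕ.suc n) z
β-positive z 0≤z z≤¼ n = proj₁ (controlled z 0≤z z≤¼ n)

unit-fraction : ∀ m → + 1 / ℕ.suc m ≡ mkℚ (+ 1) m (1-coprimeTo (ℕ.suc m))
unit-fraction m = fromℚᵘ-toℚᵘ (mkℚ (+ 1) m (1-coprimeTo (ℕ.suc m)))

unit-fraction-nonNeg : ∀ m → 0ℚ ≤ℚ + 1 / ℕ.suc m
unit-fraction-nonNeg m rewrite unit-fraction m = *≤* (ℤ.+≤+ ℕ.z≤n)

unit-fraction-≤¼ : ∀ m → 4 ≤ ℕ.suc m → + 1 / ℕ.suc m ≤ℚ ¼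
unit-fraction-≤¼ m 4≤N rewrite unit-fraction m = *≤* (ℤ.+≤+ (ℕ.*-monoʳ-≤ 1 4≤N))

lemma5p7 : (N : ℕ) .{{_ : NonZero N}} → 4 ≤ N →
    (n : ℕ) → 1 ≤ n → β n (+ 1 / N) ≢ 0ℚ
lemma5p7 (ℕ.suc m) 4≤N (ℕ.suc n) _ βₙ≡0 =
  <-irrefl (sym βₙ≡0)
    (β-positive (+ 1 / ℕ.suc m) (unit-fraction-nonNeg m) (unit-fraction-≤¼ m 4≤N) n)
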